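{- Let $L=L'\times L''$ be a product of finite geometric lattices, and let $x=(x',x'')$, $y=(y',y'')\in L$ with $x\le y$. Set $d_1=\operatorname{rk}(y')-\operatorname{rk}(x')$, $d_2=\operatorname{rk}(y'')-\operatorname{rk}(x'')$, and $d=d_1+d_2$. Then \[ \langle e_x,H_L^de_y\rangle=\binom{d}{d_1}\langle e_{x'},H_{L'}^{d_1}e_{y'}\rangle\,\langle e_{x''},H_{L''}^{d_2}e_{y''}\rangle. \]
   Context: For a finite geometric lattice $L$ with bottom $\hat0$ and rank function $\operatorname{rk}$, $\mathbb{R}[L]$ is the real vector space with orthonormal basis $\{e_x:x\in L\}$ (inner product $\langle\cdot,\cdot\rangle$), basis vectors identified with lattice elements. The diamond product is given on basis elements by $x\diamond y=x\vee y$ if $x\wedge y=\hat0$ and $0$ otherwise. For an atom $a$, $L_a(x)=a\diamond x$, $L_a^t$ is its transpose, and the lattice Hamiltonian is $H_L=\sum_{a\in\mathcal{A}(L)}(L_a+L_a^t)/2$, where $\mathcal{A}(L)$ is the set of atoms. The product lattice is ordered componentwise. -}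

module Defs where

open import Data.Bool using (Bool; true; false; if_then_else_; not; _∧_; _∨_)
open import Data.Nat using (ℕ; zero; suc; _+_; _≤_)
open import Data.Integer using (+_)
open import Data.Rational using (ℚ; 0ℚ; 1ℚ; ½; _/_) renaming (_+_ to _+ℚ_; _*_ to _*ℚ_)
open import Data.Product using (_×_; _,_; proj₁; proj₂)
open import Data.Product.Properties using (≡-dec)
open import Data.List using (List; foldr; filterᵇ; cartesianProduct)
open import Data.Bool.ListAction using (all)
open import Data.List.Membership.Propositional using (_∈_)
open import Data.List.Membership.Propositional.Properties using (∈-cartesianProduct⁺)
open import Data.List.Relation.Unary.Unique.Propositional using (Unique)
open import Data.List.Relation.Unary.Unique.Propositional.Properties using (cartesianProduct⁺)
open import Relation.Binary.PropositionalEquality using (_≡_)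
open import Relation.Binary.Definitions using (DecidableEquality)
open import Relation.Nullary using (¬_; ⌊_⌋)
open import Data.Sum using (_⊎_)
open import Algebra.Lattice.Structures using (IsLattice)

record FinLattice : Set₁ where
  field
    Carrier  : Set
    _≟_      : DecidableEquality Carrier
    elems    : List Carrier
    complete : ∀ x → x ∈ elems
    unique   : Unique elems
    _⊓_      : Carrier → Carrier → Carrier
    _⊔_      : Carrier → Carrier → Carrier
    bot      : Carrier

  infix 4 _≤L_
  _≤L_ : Carrier → Carrier → Set
  x ≤L y = x ⊔ y ≡ y

  _≡ᵇ_ : Carrier → Carrier → Bool
  x ≡ᵇ y = ⌊ x ≟ y ⌋

  _≤ᵇ_ : Carrier → Carrier → Bool
  x ≤ᵇ y = (x ⊔ y) ≡ᵇ y

  isAtom : Carrier → Bool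
  isAtom a = not (a ≡ᵇ bot) ∧ all (λ z → not (z ≤ᵇ a) ∨ (z ≡ᵇ bot) ∨ (z ≡ᵇ a)) elems

  atoms : List Carrier
  atoms = filterᵇ isAtom elems

  _⋖_ : Carrier → Carrier → Set
  x ⋖ y = x ≤L y × ¬ (x ≡ y) × (∀ z → x ≤L z → z ≤L y → z ≡ x ⊎ z ≡ y)

  joinAtomsBelow : Carrier → Carrier
  joinAtomsBelow x = foldr _⊔_ bot (filterᵇ (λ a → a ≤ᵇ x) atoms)

record IsGeometric (L : FinLattice) : Set where
  open FinLattice L
  field
    isLattice   : IsLattice _≡_ _⊔_ _⊓_
    bot-least   : ∀ x → bot ≤L x
    rk          : Carrier → ℕ
    rk-bot      : rk bot ≡ 0
    rk-cover    : ∀ x y → x ⋖ y → rk y ≡ suc (rk x)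
    semimodular : ∀ x y → rk (x ⊓ y) + rk (x ⊔ y) ≤ rk x + rk y
    atomistic   : ∀ x → x ≡ joinAtomsBelow x

open IsGeometric public
open FinLattice public

_⊗_ : FinLattice → FinLattice → FinLattice
L₁ ⊗ L₂ = record
  { Carrier  = Carrier L₁ × Carrier L₂
  ; _≟_      = ≡-dec (_≟_ L₁) (_≟_ L₂)
  ; elems    = cartesianProduct (elems L₁) (elems L₂)
  ; complete = λ p → ∈-cartesianProduct⁺ (complete L₁ (proj₁ p)) (complete L₂ (proj₂ p))
  ; unique   = cartesianProduct⁺ (unique L₁) (unique L₂)
  ; _⊓_      = λ p q → (_⊓_ L₁ (proj₁ p) (proj₁ q) , _⊓_ L₂ (proj₂ p) (proj₂ q))
  ; _⊔_      = λ p q → (_⊔_ L₁ (proj₁ p) (proj₁ q) , _⊔_ L₂ (proj₂ p) (proj₂ q))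
  ; bot      = (bot L₁ , bot L₂)
  }

-- The real vector space ℝ[L] (over ℚ, which suffices: all entries are
-- rational), with orthonormal basis e_x.

module Space (L : FinLattice) where

  Vect : Set
  Vect = Carrier L → ℚ

  Mat : Set
  Mat = Carrier L → Carrier L → ℚ

  Σ : (Carrier L → ℚ) → ℚ
  Σ f = foldr (λ z acc → f z +ℚ acc) 0ℚ (elems L)

  Σatoms : (Carrier L → ℚ) → ℚ
  Σatoms f = foldr (λ z acc → f z +ℚ acc) 0ℚ (atoms L)

  e : Carrier L → Vect
  e x z = if _≡ᵇ_ L z x then 1ℚ else 0ℚ

  ⟨_,_⟩ : Vect → Vect → ℚ
  ⟨ u , v ⟩ = Σ (λ z → u z *ℚ v z)

  _+V_ : Vect → Vect → Vect
  (u +V v) z = u z +ℚ v z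

  _⋄_ : Carrier L → Carrier L → Vect
  x ⋄ y = if _≡ᵇ_ L (_⊓_ L x y) (bot L) then e (_⊔_ L x y) else (λ _ → 0ℚ)

  apply : Mat → Vect → Vect
  apply M v z = Σ (λ w → M z w *ℚ v w)

  transpose : Mat → Mat
  transpose M z w = M w z

  -- L_a(x) = a ⋄ x, extended linearly; matrix entry (z , w) = ⟨e_z, L_a e_w⟩
  Lmat : Carrier L → Mat
  Lmat a z w = (a ⋄ w) z

  H : Mat
  H z w = Σatoms (λ a → ½ *ℚ (Lmat a z w +ℚ transpose (Lmat a) z w))

  Hpow : ℕ → Vect → Vect
  Hpow zero    v = v
  Hpow (suc d) v = apply H (Hpow d v)

ℕ→ℚ : ℕ → ℚ
ℕ→ℚ n = + n / 1

module Submission where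

-- The atoms of L₁ × L₂ are the pairs (a, 0̂) and (0̂, b), and L_(a,0̂) = L_a ⊗ 1, L_(0̂,b) = 1 ⊗ L_b.
-- Hence H_L = H₁ ⊗ 1 + 1 ⊗ H₂ is a sum of two commuting operators, and the binomial theorem gives
--   H_L^d (e_y₁ ⊗ e_y₂) = Σ_{i+j=d} C(d,i) H₁^i e_y₁ ⊗ H₂^j e_y₂.
-- Each L_a moves e_w to e_{a ∨ w} (or to 0), and rk w ≤ rk (a ∨ w) ≤ rk w + 1 by monotonicity and
-- semimodularity of rk. So H^k e_y has zero e_x-coordinate when k < rk y − rk x, and in the
-- e_x-coordinate of the sum above only the term (i, j) = (d₁, d₂) survives.

open import Defs
open import Algebra.Bundles using (CommutativeMonoid)
open import Algebra.Lattice.Bundles using (Lattice)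
open import Algebra.Lattice.Structures using (IsLattice)
open import Data.Bool using (Bool; true; false; if_then_else_)
open import Data.Bool.ListAction using (all)
open import Data.Integer using (+_)
import Data.Integer as ℤ
import Data.Integer.Properties as ℤ
open import Data.List using (List; []; _∷_; foldr; map; _++_; filter; cartesianProduct; length)
open import Data.List.Membership.Propositional using (_∈_; lose)
open import Data.List.Relation.Binary.Sublist.Propositional using (⊆-refl)
open import Data.List.Relation.Binary.Sublist.Propositional.Properties using (filter⁺; length-mono-≤)
open import Data.List.Relation.Unary.All as All using (All; []; _∷_)
open import Data.List.Relation.Unary.AllPairs using (_∷_)
open import Data.List.Relation.Unary.Any using (here; there; any?; satisfied)
open import Data.List.Relation.Unary.Unique.Propositional using (Unique)
open import Data.Nat using (ℕ; zero; suc; _+_; _∸_; _<_; _≤_; s≤s)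
open import Data.Nat.Combinatorics using (_C_; nCn≡1; nCk+nC[k+1]≡[n+1]C[k+1])
import Data.Nat.Coprimality as Coprime
open import Data.Nat.Induction using (<-wellFounded)
import Data.Nat.Properties as ℕ
open import Data.Product using (_×_; _,_; proj₁; proj₂)
open import Data.Rational using (ℚ; 0ℚ; 1ℚ; ½; mkℚ; _/_) renaming (_+_ to _+ℚ_; _*_ to _*ℚ_)
import Data.Rational.Properties as ℚ
open import Data.Rational.Solver using (module +-*-Solver)
open import Data.Sum using (_⊎_; inj₁; inj₂)
open import Function using (_∘_; _⇔_; mk⇔; Equivalence)
open import Induction.WellFounded using (Acc; acc)
open import Level using (0ℓ)
open import Relation.Binary.Definitions using (DecidableEquality; tri<; tri≈; tri>)
open import Relation.Binary.PropositionalEquality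
open import Relation.Nullary using (¬_; Dec; ⌊_⌋; yes; no; does; contradiction)
open import Relation.Nullary.Decidable using (_×-dec_; ¬?; T?; toWitness; fromWitness)
open import Relation.Nullary.Reflects
  using (Reflects; ofʸ; ofⁿ; fromEquivalence; det; ¬-reflects; _×-reflects_; _⊎-reflects_; _→-reflects_)
open import Relation.Unary using (Decidable)

open import Algebra.Properties.CommutativeSemigroup
  (CommutativeMonoid.commutativeSemigroup ℚ.+-0-commutativeMonoid) using (interchange; x∙yz≈y∙xz)
open +-*-Solver

-- Finite sums

module _ {A : Set} where

  ∑ : List A → (A → ℚ) → ℚ
  ∑ l f = foldr (λ z acc → f z +ℚ acc) 0ℚ l

  ∑-cong : ∀ l {f g : A → ℚ} → (∀ z → f z ≡ g z) → ∑ l f ≡ ∑ l g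
  ∑-cong []      f≗g = refl
  ∑-cong (x ∷ l) f≗g = cong₂ _+ℚ_ (f≗g x) (∑-cong l f≗g)

  ∑-zero : ∀ {l} {f : A → ℚ} → All (λ z → f z ≡ 0ℚ) l → ∑ l f ≡ 0ℚ
  ∑-zero []           = refl
  ∑-zero (fx≡0 ∷ f≡0) = cong₂ _+ℚ_ fx≡0 (∑-zero f≡0)

  ∑-+ : ∀ l (f g : A → ℚ) → ∑ l (λ z → f z +ℚ g z) ≡ ∑ l f +ℚ ∑ l g
  ∑-+ []      f g = refl
  ∑-+ (x ∷ l) f g =
    trans (cong (f x +ℚ g x +ℚ_) (∑-+ l f g)) (interchange (f x) (g x) (∑ l f) (∑ l g))

  ∑-*ˡ : ∀ l c (f : A → ℚ) → ∑ l (λ z → c *ℚ f z) ≡ c *ℚ ∑ l f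
  ∑-*ˡ []      c f = sym (ℚ.*-zeroʳ c)
  ∑-*ˡ (x ∷ l) c f = trans (cong (c *ℚ f x +ℚ_) (∑-*ˡ l c f)) (sym (ℚ.*-distribˡ-+ c (f x) (∑ l f)))

  ∑-*ʳ : ∀ l c (f : A → ℚ) → ∑ l (λ z → f z *ℚ c) ≡ ∑ l f *ℚ c
  ∑-*ʳ l c f = trans (∑-cong l (λ z → ℚ.*-comm (f z) c)) (trans (∑-*ˡ l c f) (ℚ.*-comm c (∑ l f)))

  ∑-++ : ∀ xs ys (f : A → ℚ) → ∑ (xs ++ ys) f ≡ ∑ xs f +ℚ ∑ ys f
  ∑-++ []       ys f = sym (ℚ.+-identityˡ (∑ ys f))
  ∑-++ (x ∷ xs) ys f =
    trans (cong (f x +ℚ_) (∑-++ xs ys f)) (sym (ℚ.+-assoc (f x) (∑ xs f) (∑ ys f)))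

  ∑-filter : ∀ {P : A → Set} (P? : Decidable P) l (f : A → ℚ) →
             ∑ (filter P? l) f ≡ ∑ l (λ z → if does (P? z) then f z else 0ℚ)
  ∑-filter P? []      f = refl
  ∑-filter P? (x ∷ l) f with does (P? x)
  ... | true  = cong (f x +ℚ_) (∑-filter P? l f)
  ... | false = trans (∑-filter P? l f) (sym (ℚ.+-identityˡ _))

  module _ (_≟_ : DecidableEquality A) where

    if-≟-≢ : ∀ {x z} (a b : ℚ) → x ≢ z → (if ⌊ z ≟ x ⌋ then a else b) ≡ b
    if-≟-≢ {x} {z} a b x≢z with z ≟ x
    ... | yes z≡x = contradiction (sym z≡x) x≢z
    ... | no  _   = refl

    ∑-sift : ∀ {l x} (f : A → ℚ) → Unique l → x ∈ l →
             ∑ l (λ z → if ⌊ z ≟ x ⌋ then f z else 0ℚ) ≡ f x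
    ∑-sift {x = x} f (x≢ ∷ _) (here refl) with x ≟ x
    ... | yes _   =
      trans (cong (f x +ℚ_) (∑-zero (All.map (if-≟-≢ _ 0ℚ) x≢))) (ℚ.+-identityʳ (f x))
    ... | no  x≢x = contradiction refl x≢x
    ∑-sift {x = x} f (y≢ ∷ u) (there x∈l) =
      trans (cong₂ _+ℚ_ (if-≟-≢ _ 0ℚ (≢-sym (All.lookup y≢ x∈l))) (∑-sift f u x∈l)) (ℚ.+-identityˡ (f x))

∑-map : ∀ {A B : Set} (g : A → B) l (f : B → ℚ) → ∑ (map g l) f ≡ ∑ l (λ z → f (g z))
∑-map g []      f = refl
∑-map g (x ∷ l) f = cong (f (g x) +ℚ_) (∑-map g l f)

module _ {A B : Set} where

  ∑-cartesianProduct : ∀ xs ys (f : A × B → ℚ) →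
                       ∑ (cartesianProduct xs ys) f ≡ ∑ xs (λ x → ∑ ys (λ y → f (x , y)))
  ∑-cartesianProduct []       ys f = refl
  ∑-cartesianProduct (x ∷ xs) ys f = begin
    ∑ (map (λ y → (x , y)) ys ++ cartesianProduct xs ys) f
      ≡⟨ ∑-++ (map (λ y → (x , y)) ys) (cartesianProduct xs ys) f ⟩
    ∑ (map (λ y → (x , y)) ys) f +ℚ ∑ (cartesianProduct xs ys) f
      ≡⟨ cong₂ _+ℚ_ (∑-map (λ y → (x , y)) ys f) (∑-cartesianProduct xs ys f) ⟩
    ∑ ys (λ y → f (x , y)) +ℚ ∑ xs (λ x → ∑ ys (λ y → f (x , y))) ∎
    where open ≡-Reasoning

  ∑-cartesianProduct-* : ∀ xs ys (f : A → ℚ) (g : B → ℚ) →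
                         ∑ (cartesianProduct xs ys) (λ p → f (proj₁ p) *ℚ g (proj₂ p)) ≡ ∑ xs f *ℚ ∑ ys g
  ∑-cartesianProduct-* xs ys f g = begin
    ∑ (cartesianProduct xs ys) (λ p → f (proj₁ p) *ℚ g (proj₂ p))
      ≡⟨ ∑-cartesianProduct xs ys (λ p → f (proj₁ p) *ℚ g (proj₂ p)) ⟩
    ∑ xs (λ x → ∑ ys (λ y → f x *ℚ g y)) ≡⟨ ∑-cong xs (λ x → ∑-*ˡ ys (f x) g) ⟩
    ∑ xs (λ x → f x *ℚ ∑ ys g)           ≡⟨ ∑-*ʳ xs (∑ ys g) f ⟩
    ∑ xs f *ℚ ∑ ys g                     ∎
    where open ≡-Reasoning

-- Antidiagonal sums and Pascal's triangle

i<n∸m⇒m+i<n : ∀ {i m n} → i < n ∸ m → m + i < n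
i<n∸m⇒m+i<n {i} {m} {n} i<n∸m =
  subst (m + i <_) (ℕ.m+[n∸m]≡n (ℕ.<⇒≤ (ℕ.m∸n≢0⇒n<m {n} {m} (ℕ.m<n⇒n≢0 i<n∸m)))) (ℕ.+-monoʳ-< m i<n∸m)

i+j≡m+n⇒i≢m⇒i<m⊎j<n : ∀ {i j m n} → i + j ≡ m + n → i ≢ m → i < m ⊎ j < n
i+j≡m+n⇒i≢m⇒i<m⊎j<n {i} {j} {m} {n} i+j≡m+n i≢m with ℕ.<-cmp i m
... | tri< i<m _ _ = inj₁ i<m
... | tri≈ _ i≡m _ = contradiction i≡m i≢m
... | tri> _ _ m<i = inj₂ (ℕ.+-cancelˡ-< m j n (subst (m + j <_) i+j≡m+n (ℕ.+-monoˡ-< j m<i)))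

∑-antidiag : ℕ → (ℕ → ℕ → ℚ) → ℚ
∑-antidiag zero    f = f 0 0
∑-antidiag (suc n) f = f 0 (suc n) +ℚ ∑-antidiag n (λ i j → f (suc i) j)

∑-antidiag-cong : ∀ n {f g : ℕ → ℕ → ℚ} → (∀ i j → f i j ≡ g i j) → ∑-antidiag n f ≡ ∑-antidiag n g
∑-antidiag-cong zero    f≗g = f≗g 0 0
∑-antidiag-cong (suc n) f≗g = cong₂ _+ℚ_ (f≗g 0 (suc n)) (∑-antidiag-cong n (λ i → f≗g (suc i)))

∑-antidiag-zero : ∀ n {f : ℕ → ℕ → ℚ} → (∀ i j → i + j ≡ n → f i j ≡ 0ℚ) → ∑-antidiag n f ≡ 0ℚ
∑-antidiag-zero zero    f≡0 = f≡0 0 0 refl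
∑-antidiag-zero (suc n) f≡0 =
  cong₂ _+ℚ_ (f≡0 0 (suc n) refl) (∑-antidiag-zero n (λ i j i+j≡n → f≡0 (suc i) j (cong suc i+j≡n)))

∑-antidiag-+ : ∀ n (f g : ℕ → ℕ → ℚ) →
               ∑-antidiag n (λ i j → f i j +ℚ g i j) ≡ ∑-antidiag n f +ℚ ∑-antidiag n g
∑-antidiag-+ zero    f g = refl
∑-antidiag-+ (suc n) f g =
  trans (cong (f 0 (suc n) +ℚ g 0 (suc n) +ℚ_) (∑-antidiag-+ n _ _))
        (interchange (f 0 (suc n)) (g 0 (suc n)) _ _)

∑-antidiag-*ˡ : ∀ n c (f : ℕ → ℕ → ℚ) → ∑-antidiag n (λ i j → c *ℚ f i j) ≡ c *ℚ ∑-antidiag n f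
∑-antidiag-*ˡ zero    c f = refl
∑-antidiag-*ˡ (suc n) c f =
  trans (cong (c *ℚ f 0 (suc n) +ℚ_) (∑-antidiag-*ˡ n c _)) (sym (ℚ.*-distribˡ-+ c _ _))

∑-∑-antidiag : ∀ {A : Set} (l : List A) n (f : A → ℕ → ℕ → ℚ) →
               ∑ l (λ w → ∑-antidiag n (f w)) ≡ ∑-antidiag n (λ i j → ∑ l (λ w → f w i j))
∑-∑-antidiag l zero    f = refl
∑-∑-antidiag l (suc n) f =
  trans (∑-+ l (λ w → f w 0 (suc n)) _)
        (cong (∑ l (λ w → f w 0 (suc n)) +ℚ_) (∑-∑-antidiag l n (λ w i → f w (suc i))))

∑-antidiag-sucʳ : ∀ n (f : ℕ → ℕ → ℚ) →
                  ∑-antidiag (suc n) f ≡ ∑-antidiag n (λ i j → f i (suc j)) +ℚ f (suc n) 0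
∑-antidiag-sucʳ zero    f = refl
∑-antidiag-sucʳ (suc n) f =
  trans (cong (f 0 (suc (suc n)) +ℚ_) (∑-antidiag-sucʳ n (λ i → f (suc i))))
        (sym (ℚ.+-assoc (f 0 (suc (suc n))) _ (f (suc (suc n)) 0)))

∑-antidiag-single : ∀ p q (f : ℕ → ℕ → ℚ) → (∀ i j → i + j ≡ p + q → i ≢ p → f i j ≡ 0ℚ) →
                    ∑-antidiag (p + q) f ≡ f p q
∑-antidiag-single zero zero    f f≡0 = refl
∑-antidiag-single zero (suc q) f f≡0 =
  trans (cong (f 0 (suc q) +ℚ_)
              (∑-antidiag-zero q (λ i j i+j≡q → f≡0 (suc i) j (cong suc i+j≡q) λ ())))
        (ℚ.+-identityʳ (f 0 (suc q)))
∑-antidiag-single (suc p) q f f≡0 =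
  trans (cong₂ _+ℚ_ (f≡0 0 (suc (p + q)) refl λ ())
                    (∑-antidiag-single p q (λ i → f (suc i)) (λ i j i+j≡p+q i≢p →
                       f≡0 (suc i) j (cong suc i+j≡p+q) (i≢p ∘ ℕ.suc-injective))))
        (ℚ.+-identityˡ (f (suc p) q))

pascal : ℕ → ℕ → ℚ
pascal zero    j       = 1ℚ
pascal (suc i) zero    = 1ℚ
pascal (suc i) (suc j) = pascal i (suc j) +ℚ pascal (suc i) j

ℕ→ℚ≡mkℚ : ∀ k → ℕ→ℚ k ≡ mkℚ (+ k) 0 (Coprime.sym (Coprime.1-coprimeTo k))
ℕ→ℚ≡mkℚ k = ℚ.normalize-coprime (Coprime.sym (Coprime.1-coprimeTo k))

ℕ→ℚ-+ : ∀ m n → ℕ→ℚ (m + n) ≡ ℕ→ℚ m +ℚ ℕ→ℚ n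
-- With both summands in normal form mkℚ (+ k) 0, their sum computes to (+ m ℤ.* + 1 ℤ.+ + n ℤ.* + 1) / 1.
ℕ→ℚ-+ m n rewrite ℕ→ℚ≡mkℚ m | ℕ→ℚ≡mkℚ n =
  cong (_/ 1) (sym (cong₂ ℤ._+_ (ℤ.*-identityʳ (+ m)) (ℤ.*-identityʳ (+ n))))

pascal≡C : ∀ i j → pascal i j ≡ ℕ→ℚ ((i + j) C i)
pascal≡C zero    j       = refl
pascal≡C (suc i) zero    =
  cong ℕ→ℚ (sym (trans (cong (_C suc i) (ℕ.+-identityʳ (suc i))) (nCn≡1 (suc i))))
pascal≡C (suc i) (suc j) = begin
  pascal i (suc j) +ℚ pascal (suc i) j
    ≡⟨ cong₂ _+ℚ_ (pascal≡C i (suc j)) (pascal≡C (suc i) j) ⟩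
  ℕ→ℚ (n C i) +ℚ ℕ→ℚ ((suc i + j) C suc i)
    ≡⟨ cong (λ k → ℕ→ℚ (n C i) +ℚ ℕ→ℚ (k C suc i)) (sym (ℕ.+-suc i j)) ⟩
  ℕ→ℚ (n C i) +ℚ ℕ→ℚ (n C suc i)      ≡⟨ sym (ℕ→ℚ-+ (n C i) (n C suc i)) ⟩
  ℕ→ℚ (n C i + n C suc i)            ≡⟨ cong ℕ→ℚ (nCk+nC[k+1]≡[n+1]C[k+1] n i) ⟩
  ℕ→ℚ (suc n C suc i)                ∎
  where
  open ≡-Reasoning
  n = i + suc j

-- Pascal's rule splits each weight in two: one part makes up the Up sum, the other
-- (Rest), reindexed, the Right sum.
∑-antidiag-pascal : ∀ (a : ℕ → ℕ → ℚ) n →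
                    ∑-antidiag (suc n) (λ i j → pascal i j *ℚ a i j)
                    ≡ ∑-antidiag n (λ i j → pascal i j *ℚ (a (suc i) j +ℚ a i (suc j)))
∑-antidiag-pascal a n = begin
  W 0 (suc n) +ℚ ∑-antidiag n (λ i → W (suc i))
    ≡⟨ cong (W 0 (suc n) +ℚ_) (trans (∑-antidiag-cong n W-split) (∑-antidiag-+ n Up Rest)) ⟩
  W 0 (suc n) +ℚ (∑-antidiag n Up +ℚ ∑-antidiag n Rest)
    ≡⟨ x∙yz≈y∙xz (W 0 (suc n)) (∑-antidiag n Up) (∑-antidiag n Rest) ⟩
  ∑-antidiag n Up +ℚ (W 0 (suc n) +ℚ ∑-antidiag n Rest)
    ≡⟨ cong (∑-antidiag n Up +ℚ_) (Rest-completes n) ⟩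
  ∑-antidiag n Up +ℚ ∑-antidiag n Right
    ≡⟨ sym (trans (∑-antidiag-cong n distrib) (∑-antidiag-+ n Up Right)) ⟩
  ∑-antidiag n (λ i j → pascal i j *ℚ (a (suc i) j +ℚ a i (suc j))) ∎
  where
  open ≡-Reasoning
  W Up Right Rest : ℕ → ℕ → ℚ
  W     i j       = pascal i j *ℚ a i j
  Up    i j       = pascal i j *ℚ a (suc i) j
  Right i j       = pascal i j *ℚ a i (suc j)
  Rest  i zero    = 0ℚ
  Rest  i (suc j) = pascal (suc i) j *ℚ a (suc i) (suc j)

  distrib : ∀ i j → pascal i j *ℚ (a (suc i) j +ℚ a i (suc j)) ≡ Up i j +ℚ Right i j
  distrib i j = ℚ.*-distribˡ-+ (pascal i j) _ _

  W-split : ∀ i j → W (suc i) j ≡ Up i j +ℚ Rest i j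
  W-split zero    zero    = sym (ℚ.+-identityʳ _)
  W-split (suc i) zero    = sym (ℚ.+-identityʳ _)
  W-split i       (suc j) = ℚ.*-distribʳ-+ (a (suc i) (suc j)) (pascal i (suc j)) (pascal (suc i) j)

  Rest-completes : ∀ n → W 0 (suc n) +ℚ ∑-antidiag n Rest ≡ ∑-antidiag n Right
  Rest-completes zero    = ℚ.+-identityʳ _
  Rest-completes (suc n) =
    cong (W 0 (suc (suc n)) +ℚ_) (trans (∑-antidiag-sucʳ n Rest) (ℚ.+-identityʳ _))

length-filter-< : ∀ {A : Set} {P Q : A → Set} (P? : Decidable P) (Q? : Decidable Q) →
                  (∀ {z} → P z → Q z) → ∀ {v xs} → v ∈ xs → ¬ P v → Q v →
                  length (filter P? xs) < length (filter Q? xs)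
length-filter-< P? Q? P⇒Q {xs = x ∷ xs} v∈ ¬Pv Qv with P? x | Q? x | v∈
... | yes Px | _      | here refl  = contradiction Px ¬Pv
... | yes Px | no ¬Qx | _          = contradiction (P⇒Q Px) ¬Qx
... | no _   | no ¬Qx | here refl  = contradiction Qv ¬Qx
... | no _   | yes _  | here refl  =
  s≤s (length-mono-≤ (filter⁺ P? Q? (λ { refl → P⇒Q }) (⊆-refl {x = xs})))
... | yes _  | yes _  | there v∈xs = s≤s (length-filter-< P? Q? P⇒Q v∈xs ¬Pv Qv)
... | no _   | yes _  | there v∈xs = ℕ.m<n⇒m<1+n (length-filter-< P? Q? P⇒Q v∈xs ¬Pv Qv)
... | no _   | no _   | there v∈xs = length-filter-< P? Q? P⇒Q v∈xs ¬Pv Qv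

reflects-⇔ : ∀ {A B : Set} {b} → Reflects A b → A ⇔ B → Reflects B b
reflects-⇔ (ofʸ a)  A⇔B = ofʸ (Equivalence.to A⇔B a)
reflects-⇔ (ofⁿ ¬a) A⇔B = ofⁿ (¬a ∘ Equivalence.from A⇔B)

all-reflects : ∀ {A : Set} {P : A → Set} {p : A → Bool} →
               (∀ x → Reflects (P x) (p x)) → ∀ xs → Reflects (All P xs) (all p xs)
all-reflects P⇔p []       = ofʸ []
all-reflects P⇔p (x ∷ xs) =
  reflects-⇔ (P⇔p x ×-reflects all-reflects P⇔p xs) (mk⇔ (λ (px , pxs) → px ∷ pxs) All.uncons)

-- Finite geometric lattices

module FinLatticeProperties (L : FinLattice) where
  open FinLattice L using () renaming (Carrier to E; _⊔_ to _∨_; bot to 0̂; _≤L_ to _≼_)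

  IsAtom : E → Set
  IsAtom a = a ≢ 0̂ × (∀ z → z ≼ a → z ≡ 0̂ ⊎ z ≡ a)

  ≡ᵇ-reflects : ∀ x y → Reflects (x ≡ y) (_≡ᵇ_ L x y)
  ≡ᵇ-reflects x y = fromEquivalence toWitness fromWitness

  isAtom-reflects : ∀ a → Reflects (IsAtom a) (isAtom L a)
  isAtom-reflects a =
    reflects-⇔ (¬-reflects (≡ᵇ-reflects a 0̂) ×-reflects all-reflects below-a (elems L))
               (mk⇔ (λ (a≢0̂ , all-below) → a≢0̂ , λ z → All.lookup all-below (complete L z))
                    (λ (a≢0̂ , ∀z) → a≢0̂ , All.universal ∀z (elems L)))
    where
    below-a : ∀ z → Reflects (z ≼ a → z ≡ 0̂ ⊎ z ≡ a) _
    below-a z = ≡ᵇ-reflects (z ∨ a) a →-reflects (≡ᵇ-reflects z 0̂ ⊎-reflects ≡ᵇ-reflects z a)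

  ≡⇒≡ᵇ : ∀ {x y} → x ≡ y → _≡ᵇ_ L x y ≡ true
  ≡⇒≡ᵇ {x} {y} x≡y = det (≡ᵇ-reflects x y) (ofʸ x≡y)

  isAtom-0̂ : isAtom L 0̂ ≡ false
  isAtom-0̂ = det (isAtom-reflects 0̂) (ofⁿ λ (0̂≢0̂ , _) → 0̂≢0̂ refl)

module GeometricLatticeProperties (L : FinLattice) (G : IsGeometric L) where
  open FinLattice L using () renaming (Carrier to E; _⊔_ to _∨_; _⊓_ to _∧_; bot to 0̂; _≤L_ to _≼_; _≟_ to _≟ₗ_)
  open IsLattice (isLattice G) using (∨-comm; ∨-assoc; ∧-absorbs-∨)

  lattice : Lattice 0ℓ 0ℓ
  lattice = record { isLattice = isLattice G }

  open import Algebra.Lattice.Properties.Lattice lattice using (∨-idem)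
  open FinLatticeProperties L

  ≼-refl : ∀ x → x ≼ x
  ≼-refl = ∨-idem

  ≼-trans : ∀ {x y z} → x ≼ y → y ≼ z → x ≼ z
  ≼-trans {x} {y} {z} x≼y y≼z = begin
    x ∨ z       ≡⟨ cong (x ∨_) (sym y≼z) ⟩
    x ∨ (y ∨ z) ≡⟨ sym (∨-assoc x y z) ⟩
    (x ∨ y) ∨ z ≡⟨ cong (_∨ z) x≼y ⟩
    y ∨ z       ≡⟨ y≼z ⟩
    z           ∎
    where open ≡-Reasoning

  ≼-antisym : ∀ {x y} → x ≼ y → y ≼ x → x ≡ y
  ≼-antisym {x} {y} x≼y y≼x = trans (sym y≼x) (trans (∨-comm y x) x≼y)

  ≼-∨ʳ : ∀ a x → x ≼ a ∨ x
  ≼-∨ʳ a x = trans (∨-comm x (a ∨ x)) (trans (∨-assoc a x x) (cong (a ∨_) (∨-idem x)))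

  ≼-0̂ : ∀ {x} → x ≼ 0̂ → x ≡ 0̂
  ≼-0̂ {x} x≼0̂ = trans (sym (trans (∨-comm x 0̂) (bot-least G x))) x≼0̂

  0̂-∧ : ∀ x → 0̂ ∧ x ≡ 0̂
  0̂-∧ x = trans (cong (0̂ ∧_) (sym (bot-least G x))) (∧-absorbs-∨ 0̂ x)

  _≼?_ : ∀ x y → Dec (x ≼ y)
  x ≼? y = (x ∨ y) ≟ₗ y

  _≺_ : E → E → Set
  x ≺ y = x ≼ y × x ≢ y

  _≺?_ : ∀ x y → Dec (x ≺ y)
  x ≺? y = x ≼? y ×-dec ¬? (x ≟ₗ y)

  interval : E → E → ℕ
  interval x y = length (filter (λ z → x ≼? z ×-dec z ≼? y) (elems L))

  interval-shrinksˡ : ∀ {x u y} → x ≺ u → u ≼ y → interval u y < interval x y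
  interval-shrinksˡ {x} (x≼u , x≢u) u≼y =
    length-filter-< _ _ (λ (u≼z , z≼y) → ≼-trans x≼u u≼z , z≼y) (complete L x)
                    (λ (u≼x , _) → x≢u (≼-antisym x≼u u≼x)) (≼-refl x , ≼-trans x≼u u≼y)

  interval-shrinksʳ : ∀ {x u y} → x ≼ u → u ≺ y → interval x u < interval x y
  interval-shrinksʳ {y = y} x≼u (u≼y , u≢y) =
    length-filter-< _ _ (λ (x≼z , z≼u) → x≼z , ≼-trans z≼u u≼y) (complete L y)
                    (λ (_ , y≼u) → u≢y (≼-antisym u≼y y≼u)) (≼-trans x≼u u≼y , ≼-refl y)

  -- Either some u lies strictly between x and y, splitting [x, y] into two smaller intervals, or y covers x.
  rk-mono-acc : ∀ {x y} → Acc _<_ (interval x y) → x ≼ y → rk G x ≤ rk G y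
  rk-mono-acc {x} {y} (acc smaller) x≼y with x ≟ₗ y
  ... | yes refl = ℕ.≤-refl
  ... | no x≢y with any? (λ u → x ≺? u ×-dec u ≺? y) (elems L)
  ...   | yes between = let (u , x≺u , u≺y) = satisfied between in
    ℕ.≤-trans (rk-mono-acc (smaller (interval-shrinksʳ (proj₁ x≺u) u≺y)) (proj₁ x≺u))
              (rk-mono-acc (smaller (interval-shrinksˡ x≺u (proj₁ u≺y))) (proj₁ u≺y))
  ...   | no nothing-between =
    subst (rk G x ≤_) (sym (rk-cover G x y (x≼y , x≢y , covered))) (ℕ.n≤1+n (rk G x))
    where
    covered : ∀ z → x ≼ z → z ≼ y → z ≡ x ⊎ z ≡ y
    covered z x≼z z≼y with z ≟ₗ x | z ≟ₗ y
    ... | yes z≡x | _       = inj₁ z≡x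
    ... | no _    | yes z≡y = inj₂ z≡y
    ... | no z≢x  | no z≢y  =
      contradiction (lose (complete L z) ((x≼z , z≢x ∘ sym) , (z≼y , z≢y))) nothing-between

  rk-mono : ∀ {x y} → x ≼ y → rk G x ≤ rk G y
  rk-mono = rk-mono-acc (<-wellFounded _)

  rk-atom : ∀ {a} → IsAtom a → rk G a ≡ 1
  rk-atom {a} (a≢0̂ , below-a) =
    trans (rk-cover G 0̂ a (bot-least G a , a≢0̂ ∘ sym , λ z _ z≼a → below-a z z≼a)) (cong suc (rk-bot G))

  rk-∨-atom : ∀ {a w} → IsAtom a → a ∧ w ≡ 0̂ → rk G (a ∨ w) ≤ suc (rk G w)
  rk-∨-atom {a} {w} atom a∧w≡0̂ = begin
    rk G (a ∨ w)                ≡⟨ cong (_+ rk G (a ∨ w)) (sym (trans (cong (rk G) a∧w≡0̂) (rk-bot G))) ⟩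
    rk G (a ∧ w) + rk G (a ∨ w) ≤⟨ semimodular G a w ⟩
    rk G a + rk G w             ≡⟨ cong (_+ rk G w) (rk-atom atom) ⟩
    suc (rk G w)                ∎
    where open ℕ.≤-Reasoning

-- The Hamiltonian of a lattice

if-* : ∀ b c → (if b then 1ℚ else 0ℚ) *ℚ c ≡ (if b then c else 0ℚ)
if-* true  c = ℚ.*-identityˡ c
if-* false c = ℚ.*-zeroˡ c

module SpaceProperties (L : FinLattice) where
  open Space L
  open FinLattice L using () renaming (_⊔_ to _∨_; _⊓_ to _∧_; bot to 0̂; _≟_ to _≟ₗ_)

  e-≢ : ∀ {x z} → x ≢ z → e x z ≡ 0ℚ
  e-≢ = if-≟-≢ _≟ₗ_ 1ℚ 0ℚ

  e-diag : ∀ x → e x x ≡ 1ℚ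
  e-diag x with x ≟ₗ x
  ... | yes _   = refl
  ... | no  x≢x = contradiction refl x≢x

  e-sym : ∀ x y → e x y ≡ e y x
  e-sym x y with y ≟ₗ x | x ≟ₗ y
  ... | yes _   | yes _   = refl
  ... | no  _   | no  _   = refl
  ... | yes y≡x | no x≢y  = contradiction (sym y≡x) x≢y
  ... | no  y≢x | yes x≡y = contradiction (sym x≡y) y≢x

  ⟨e,-⟩ : ∀ x (v : Vect) → ⟨ e x , v ⟩ ≡ v x
  ⟨e,-⟩ x v = trans (∑-cong (elems L) (λ w → if-* (_≡ᵇ_ L w x) (v w))) (∑-sift _≟ₗ_ v (unique L) (complete L x))

  apply-cong : ∀ M {u v : Vect} → (∀ w → u w ≡ v w) → ∀ z → apply M u z ≡ apply M v z
  apply-cong M u≗v z = ∑-cong (elems L) (λ w → cong (M z w *ℚ_) (u≗v w))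

  apply-∑-antidiag : ∀ M n (c : ℕ → ℕ → ℚ) (f : ℕ → ℕ → Vect) z →
                     apply M (λ w → ∑-antidiag n (λ i j → c i j *ℚ f i j w)) z
                     ≡ ∑-antidiag n (λ i j → c i j *ℚ apply M (f i j) z)
  apply-∑-antidiag M n c f z = begin
    ∑ (elems L) (λ w → M z w *ℚ ∑-antidiag n (λ i j → c i j *ℚ f i j w))
      ≡⟨ ∑-cong (elems L) (λ w → trans (sym (∑-antidiag-*ˡ n (M z w) (λ i j → c i j *ℚ f i j w)))
                                       (∑-antidiag-cong n (λ i j → swap (M z w) (c i j) (f i j w)))) ⟩
    ∑ (elems L) (λ w → ∑-antidiag n (λ i j → c i j *ℚ (M z w *ℚ f i j w)))
      ≡⟨ ∑-∑-antidiag (elems L) n (λ w i j → c i j *ℚ (M z w *ℚ f i j w)) ⟩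
    ∑-antidiag n (λ i j → ∑ (elems L) (λ w → c i j *ℚ (M z w *ℚ f i j w)))
      ≡⟨ ∑-antidiag-cong n (λ i j → ∑-*ˡ (elems L) (c i j) (λ w → M z w *ℚ f i j w)) ⟩
    ∑-antidiag n (λ i j → c i j *ℚ apply M (f i j) z) ∎
    where
    open ≡-Reasoning
    swap : ∀ m c x → m *ℚ (c *ℚ x) ≡ c *ℚ (m *ℚ x)
    swap = solve 3 (λ m c x → m :* (c :* x) := c :* (m :* x)) refl

  Hpow-cong : ∀ {u v : Vect} → (∀ w → u w ≡ v w) → ∀ n z → Hpow n u z ≡ Hpow n v z
  Hpow-cong u≗v zero    = u≗v
  Hpow-cong u≗v (suc n) = apply-cong H (Hpow-cong u≗v n)

  Hpow-binomial : (F : ℕ → ℕ → Vect) → (∀ i j z → apply H (F i j) z ≡ F (suc i) j z +ℚ F i (suc j) z) →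
                  ∀ n z → Hpow n (F 0 0) z ≡ ∑-antidiag n (λ i j → pascal i j *ℚ F i j z)
  Hpow-binomial F H-shifts zero    z = sym (ℚ.*-identityˡ (F 0 0 z))
  Hpow-binomial F H-shifts (suc n) z = begin
    apply H (Hpow n (F 0 0)) z
      ≡⟨ apply-cong H (Hpow-binomial F H-shifts n) z ⟩
    apply H (λ w → ∑-antidiag n (λ i j → pascal i j *ℚ F i j w)) z
      ≡⟨ apply-∑-antidiag H n pascal F z ⟩
    ∑-antidiag n (λ i j → pascal i j *ℚ apply H (F i j) z)
      ≡⟨ ∑-antidiag-cong n (λ i j → cong (pascal i j *ℚ_) (H-shifts i j z)) ⟩
    ∑-antidiag n (λ i j → pascal i j *ℚ (F (suc i) j z +ℚ F i (suc j) z))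
      ≡⟨ sym (∑-antidiag-pascal (λ i j → F i j z) n) ⟩
    ∑-antidiag (suc n) (λ i j → pascal i j *ℚ F i j z) ∎
    where open ≡-Reasoning

  Lmat-outside-support : ∀ a z w → ¬ (a ∧ w ≡ 0̂ × z ≡ a ∨ w) → Lmat a z w ≡ 0ℚ
  Lmat-outside-support a z w ¬support with (a ∧ w) ≟ₗ 0̂
  ... | no  _       = refl
  ... | yes a∧w≡0̂ = e-≢ (λ a∨w≡z → ¬support (a∧w≡0̂ , sym a∨w≡z))

module HamiltonianProperties (L : FinLattice) (G : IsGeometric L) where
  open Space L
  open SpaceProperties L
  open FinLatticeProperties L
  open GeometricLatticeProperties L G

  H-vanishes : ∀ z w → suc (rk G z) < rk G w → H z w ≡ 0ℚ
  H-vanishes z w far = trans (∑-filter (T? ∘ isAtom L) (elems L) _) (∑-zero (All.universal term (elems L)))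
    where
    term : ∀ a → (if isAtom L a then ½ *ℚ (Lmat a z w +ℚ Lmat a w z) else 0ℚ) ≡ 0ℚ
    term a with isAtom L a | isAtom-reflects a
    ... | false | _         = refl
    ... | true  | ofʸ atom = trans (cong (λ t → ½ *ℚ t) (cong₂ _+ℚ_ Lzw≡0 Lwz≡0)) (ℚ.*-zeroʳ ½)
      where
      Lzw≡0 : Lmat a z w ≡ 0ℚ
      Lzw≡0 = Lmat-outside-support a z w λ (_ , z≡a∨w) →
        ℕ.<⇒≱ far (ℕ.m≤n⇒m≤1+n (subst (λ t → rk G w ≤ rk G t) (sym z≡a∨w) (rk-mono (≼-∨ʳ a w))))
      Lwz≡0 : Lmat a w z ≡ 0ℚ
      Lwz≡0 = Lmat-outside-support a w z λ (a∧z≡0̂ , w≡a∨z) →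
        ℕ.<⇒≱ far (subst (λ t → rk G t ≤ suc (rk G z)) (sym w≡a∨z) (rk-∨-atom atom a∧z≡0̂))

  Hpow-e-vanishes : ∀ y k z → rk G z + k < rk G y → Hpow k (e y) z ≡ 0ℚ
  Hpow-e-vanishes y zero    z z+0<y = e-≢ λ { refl → ℕ.m+n≮m (rk G y) 0 z+0<y }
  Hpow-e-vanishes y (suc k) z z+k+1<y = ∑-zero (All.universal term (elems L))
    where
    term : ∀ w → H z w *ℚ Hpow k (e y) w ≡ 0ℚ
    term w with rk G w + k ℕ.<? rk G y
    ... | yes w+k<y = trans (cong (H z w *ℚ_) (Hpow-e-vanishes y k w w+k<y)) (ℚ.*-zeroʳ (H z w))
    ... | no  w+k≮y = trans (cong (_*ℚ Hpow k (e y) w) (H-vanishes z w far)) (ℚ.*-zeroˡ (Hpow k (e y) w))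
      where
      far : suc (rk G z) < rk G w
      far = ℕ.+-cancelʳ-< k (suc (rk G z)) (rk G w)
              (ℕ.<-≤-trans (subst (_< rk G y) (ℕ.+-suc (rk G z) k) z+k+1<y) (ℕ.≮⇒≥ w+k≮y))

-- Product lattices

module ProductProperties (L₁ L₂ : FinLattice) (G₁ : IsGeometric L₁) (G₂ : IsGeometric L₂) where
  open import Data.Bool using (_∧_)
  open import Data.Bool.Properties using (∧-identityʳ)
  open import Data.Product.Properties using (×-≡,≡↔≡; ,-injectiveˡ; ,-injectiveʳ)
  open import Function.Properties.Inverse using (↔⇒⇔)
  import Data.Sum as Sum
  open FinLattice L₁ using () renaming (_⊔_ to _∨₁_; _⊓_ to _∧₁_; bot to 0̂₁; _≡ᵇ_ to _≡ᵇ₁_)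
  open FinLattice L₂ using () renaming (_⊔_ to _∨₂_; _⊓_ to _∧₂_; bot to 0̂₂; _≡ᵇ_ to _≡ᵇ₂_)
  module S₁ = Space L₁
  module S₂ = Space L₂
  module S = Space (L₁ ⊗ L₂)
  module Lat₁ = FinLatticeProperties L₁
  module Lat₂ = FinLatticeProperties L₂
  module Lat = FinLatticeProperties (L₁ ⊗ L₂)
  module Geo₁ = GeometricLatticeProperties L₁ G₁
  module Geo₂ = GeometricLatticeProperties L₂ G₂
  module SP₁ = SpaceProperties L₁
  module SP₂ = SpaceProperties L₂
  module SP = SpaceProperties (L₁ ⊗ L₂)
  module Ham₁ = HamiltonianProperties L₁ G₁
  module Ham₂ = HamiltonianProperties L₂ G₂

  ≡ᵇ-⊗ : ∀ x₁ x₂ y₁ y₂ → _≡ᵇ_ (L₁ ⊗ L₂) (x₁ , x₂) (y₁ , y₂) ≡ (x₁ ≡ᵇ₁ y₁) ∧ (x₂ ≡ᵇ₂ y₂)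
  ≡ᵇ-⊗ x₁ x₂ y₁ y₂ =
    det (Lat.≡ᵇ-reflects _ _)
        (reflects-⇔ (Lat₁.≡ᵇ-reflects x₁ y₁ ×-reflects Lat₂.≡ᵇ-reflects x₂ y₂) (↔⇒⇔ ×-≡,≡↔≡))

  e-⊗ : ∀ y₁ y₂ z₁ z₂ → S.e (y₁ , y₂) (z₁ , z₂) ≡ S₁.e y₁ z₁ *ℚ S₂.e y₂ z₂
  e-⊗ y₁ y₂ z₁ z₂ rewrite ≡ᵇ-⊗ z₁ z₂ y₁ y₂ = if-∧ (z₁ ≡ᵇ₁ y₁) (z₂ ≡ᵇ₂ y₂)
    where
    if-∧ : ∀ b c → (if b ∧ c then 1ℚ else 0ℚ) ≡ (if b then 1ℚ else 0ℚ) *ℚ (if c then 1ℚ else 0ℚ)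
    if-∧ true  c = sym (ℚ.*-identityˡ (if c then 1ℚ else 0ℚ))
    if-∧ false c = sym (ℚ.*-zeroˡ (if c then 1ℚ else 0ℚ))

  IsAtom-⊗-0̂ˡ : ∀ a₂ → Lat.IsAtom (0̂₁ , a₂) ⇔ Lat₂.IsAtom a₂
  IsAtom-⊗-0̂ˡ a₂ = mk⇔ to from
    where
    to : Lat.IsAtom (0̂₁ , a₂) → Lat₂.IsAtom a₂
    to (a≢0̂ , below-a) = a≢0̂ ∘ cong (0̂₁ ,_) , λ z z≼a₂ →
      Sum.map ,-injectiveʳ ,-injectiveʳ (below-a (0̂₁ , z) (cong₂ _,_ (Geo₁.≼-refl 0̂₁) z≼a₂))
    from : Lat₂.IsAtom a₂ → Lat.IsAtom (0̂₁ , a₂)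
    from (a₂≢0̂ , below-a₂) = a₂≢0̂ ∘ ,-injectiveʳ , λ (z₁ , z₂) z≼a →
      let z₁≡0̂ = Geo₁.≼-0̂ (,-injectiveˡ z≼a) in
      Sum.map (cong₂ _,_ z₁≡0̂) (cong₂ _,_ z₁≡0̂) (below-a₂ z₂ (,-injectiveʳ z≼a))

  IsAtom-⊗ : ∀ {a₁} a₂ → a₁ ≢ 0̂₁ → Lat.IsAtom (a₁ , a₂) ⇔ (Lat₁.IsAtom a₁ × a₂ ≡ 0̂₂)
  IsAtom-⊗ {a₁} a₂ a₁≢0̂ = mk⇔ to from
    where
    to : Lat.IsAtom (a₁ , a₂) → Lat₁.IsAtom a₁ × a₂ ≡ 0̂₂
    to (_ , below-a) =
      (a₁≢0̂ , below-a₁) , a₂≡0̂ (below-a (a₁ , 0̂₂) (cong₂ _,_ (Geo₁.≼-refl a₁) (bot-least G₂ a₂)))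
      where
      below-a₁ : ∀ z → _≤L_ L₁ z a₁ → z ≡ 0̂₁ ⊎ z ≡ a₁
      below-a₁ z z≼a₁ =
        Sum.map ,-injectiveˡ ,-injectiveˡ (below-a (z , 0̂₂) (cong₂ _,_ z≼a₁ (bot-least G₂ a₂)))
      a₂≡0̂ : (a₁ , 0̂₂) ≡ (0̂₁ , 0̂₂) ⊎ (a₁ , 0̂₂) ≡ (a₁ , a₂) → a₂ ≡ 0̂₂
      a₂≡0̂ (inj₁ a₁≡0̂) = contradiction (,-injectiveˡ a₁≡0̂) a₁≢0̂
      a₂≡0̂ (inj₂ 0̂≡a₂) = sym (,-injectiveʳ 0̂≡a₂)
    from : Lat₁.IsAtom a₁ × a₂ ≡ 0̂₂ → Lat.IsAtom (a₁ , a₂)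
    from ((_ , below-a₁) , refl) = a₁≢0̂ ∘ ,-injectiveˡ , λ (z₁ , z₂) z≼a →
      let z₂≡0̂ = Geo₂.≼-0̂ (,-injectiveʳ z≼a) in
      Sum.map (λ z₁≡0̂ → cong₂ _,_ z₁≡0̂ z₂≡0̂) (λ z₁≡a₁ → cong₂ _,_ z₁≡a₁ z₂≡0̂)
              (below-a₁ z₁ (,-injectiveˡ z≼a))

  isAtom-⊗-0̂ˡ : ∀ a₂ → isAtom (L₁ ⊗ L₂) (0̂₁ , a₂) ≡ isAtom L₂ a₂
  isAtom-⊗-0̂ˡ a₂ = det (reflects-⇔ (Lat.isAtom-reflects _) (IsAtom-⊗-0̂ˡ a₂)) (Lat₂.isAtom-reflects a₂)

  isAtom-⊗ : ∀ {a₁} a₂ → a₁ ≢ 0̂₁ → isAtom (L₁ ⊗ L₂) (a₁ , a₂) ≡ isAtom L₁ a₁ ∧ (a₂ ≡ᵇ₂ 0̂₂)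
  isAtom-⊗ a₂ a₁≢0̂ = det (reflects-⇔ (Lat.isAtom-reflects _) (IsAtom-⊗ a₂ a₁≢0̂))
                         (Lat₁.isAtom-reflects _ ×-reflects Lat₂.≡ᵇ-reflects a₂ 0̂₂)

  ∑-atoms-⊗-slice : ∀ (f : Carrier (L₁ ⊗ L₂) → ℚ) a₁ →
                    ∑ (elems L₂) (λ a₂ → if isAtom (L₁ ⊗ L₂) (a₁ , a₂) then f (a₁ , a₂) else 0ℚ)
                    ≡ S₁.e 0̂₁ a₁ *ℚ S₂.Σatoms (λ a₂ → f (0̂₁ , a₂)) +ℚ (if isAtom L₁ a₁ then f (a₁ , 0̂₂) else 0ℚ)
  ∑-atoms-⊗-slice f a₁ = by-cases (_≟_ L₁ a₁ 0̂₁)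
    where
    open ≡-Reasoning
    X = S₂.Σatoms (λ a₂ → f (0̂₁ , a₂))
    Y = if isAtom L₁ a₁ then f (a₁ , 0̂₂) else 0ℚ
    Slice = ∑ (elems L₂) (λ a₂ → if isAtom (L₁ ⊗ L₂) (a₁ , a₂) then f (a₁ , a₂) else 0ℚ)

    only-0̂ : ∀ b → ∑ (elems L₂) (λ a₂ → if b ∧ (a₂ ≡ᵇ₂ 0̂₂) then f (a₁ , a₂) else 0ℚ)
                   ≡ (if b then f (a₁ , 0̂₂) else 0ℚ)
    only-0̂ true  = ∑-sift (_≟_ L₂) (λ a₂ → f (a₁ , a₂)) (unique L₂) (complete L₂ 0̂₂)
    only-0̂ false = ∑-zero (All.universal (λ _ → refl) (elems L₂))

    by-cases : Dec (a₁ ≡ 0̂₁) → Slice ≡ S₁.e 0̂₁ a₁ *ℚ X +ℚ Y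
    by-cases (yes refl) = begin
      Slice ≡⟨ ∑-cong (elems L₂) (λ a₂ → cong (λ b → if b then f (0̂₁ , a₂) else 0ℚ) (isAtom-⊗-0̂ˡ a₂)) ⟩
      ∑ (elems L₂) (λ a₂ → if isAtom L₂ a₂ then f (0̂₁ , a₂) else 0ℚ)
            ≡⟨ sym (∑-filter (T? ∘ isAtom L₂) (elems L₂) (λ a₂ → f (0̂₁ , a₂))) ⟩
      X     ≡⟨ sym (trans (ℚ.+-identityʳ (1ℚ *ℚ X)) (ℚ.*-identityˡ X)) ⟩
      1ℚ *ℚ X +ℚ 0ℚ
            ≡⟨ sym (cong₂ (λ s b → s *ℚ X +ℚ (if b then f (0̂₁ , 0̂₂) else 0ℚ)) (SP₁.e-diag 0̂₁) Lat₁.isAtom-0̂) ⟩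
      S₁.e 0̂₁ 0̂₁ *ℚ X +ℚ Y ∎
    by-cases (no a₁≢0̂) = begin
      Slice ≡⟨ ∑-cong (elems L₂) (λ a₂ → cong (λ b → if b then f (a₁ , a₂) else 0ℚ) (isAtom-⊗ a₂ a₁≢0̂)) ⟩
      ∑ (elems L₂) (λ a₂ → if isAtom L₁ a₁ ∧ (a₂ ≡ᵇ₂ 0̂₂) then f (a₁ , a₂) else 0ℚ)
            ≡⟨ only-0̂ (isAtom L₁ a₁) ⟩
      Y     ≡⟨ sym (trans (cong (λ s → s *ℚ X +ℚ Y) (SP₁.e-≢ (a₁≢0̂ ∘ sym)))
                          (trans (cong (_+ℚ Y) (ℚ.*-zeroˡ X)) (ℚ.+-identityˡ Y))) ⟩
      S₁.e 0̂₁ a₁ *ℚ X +ℚ Y ∎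

  ∑-atoms-⊗ : ∀ (f : Carrier (L₁ ⊗ L₂) → ℚ) →
              S.Σatoms f ≡ S₂.Σatoms (λ a₂ → f (0̂₁ , a₂)) +ℚ S₁.Σatoms (λ a₁ → f (a₁ , 0̂₂))
  ∑-atoms-⊗ f = begin
    S.Σatoms f
      ≡⟨ ∑-filter (T? ∘ isAtom (L₁ ⊗ L₂)) (elems (L₁ ⊗ L₂)) f ⟩
    ∑ (elems (L₁ ⊗ L₂)) (λ a → if isAtom (L₁ ⊗ L₂) a then f a else 0ℚ)
      ≡⟨ ∑-cartesianProduct (elems L₁) (elems L₂) (λ a → if isAtom (L₁ ⊗ L₂) a then f a else 0ℚ) ⟩
    ∑ (elems L₁) (λ a₁ → ∑ (elems L₂) (λ a₂ → if isAtom (L₁ ⊗ L₂) (a₁ , a₂) then f (a₁ , a₂) else 0ℚ))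
      ≡⟨ ∑-cong (elems L₁) (∑-atoms-⊗-slice f) ⟩
    ∑ (elems L₁) (λ a₁ → S₁.e 0̂₁ a₁ *ℚ X +ℚ Y a₁)
      ≡⟨ ∑-+ (elems L₁) (λ a₁ → S₁.e 0̂₁ a₁ *ℚ X) Y ⟩
    S₁.⟨ S₁.e 0̂₁ , (λ _ → X) ⟩ +ℚ ∑ (elems L₁) Y
      ≡⟨ cong₂ _+ℚ_ (SP₁.⟨e,-⟩ 0̂₁ (λ _ → X)) (sym (∑-filter (T? ∘ isAtom L₁) (elems L₁) (λ a₁ → f (a₁ , 0̂₂)))) ⟩
    X +ℚ S₁.Σatoms (λ a₁ → f (a₁ , 0̂₂)) ∎
    where
    open ≡-Reasoning
    X = S₂.Σatoms (λ a₂ → f (0̂₁ , a₂))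
    Y = λ a₁ → if isAtom L₁ a₁ then f (a₁ , 0̂₂) else 0ℚ

  Lmat-⊗ˡ : ∀ a₁ z₁ z₂ w₁ w₂ → S.Lmat (a₁ , 0̂₂) (z₁ , z₂) (w₁ , w₂) ≡ S₁.Lmat a₁ z₁ w₁ *ℚ S₂.e w₂ z₂
  Lmat-⊗ˡ a₁ z₁ z₂ w₁ w₂ =
    trans (cong (λ b → (if b then S.e (a₁ ∨₁ w₁ , 0̂₂ ∨₂ w₂) else (λ _ → 0ℚ)) (z₁ , z₂)) disjoint)
          (by-cases ((a₁ ∧₁ w₁) ≡ᵇ₁ 0̂₁))
    where
    disjoint : _≡ᵇ_ (L₁ ⊗ L₂) (a₁ ∧₁ w₁ , 0̂₂ ∧₂ w₂) (0̂₁ , 0̂₂) ≡ (a₁ ∧₁ w₁) ≡ᵇ₁ 0̂₁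
    disjoint = trans (≡ᵇ-⊗ _ _ _ _) (trans (cong (_ ∧_) (Lat₂.≡⇒≡ᵇ (Geo₂.0̂-∧ w₂))) (∧-identityʳ _))
    by-cases : ∀ b → (if b then S.e (a₁ ∨₁ w₁ , 0̂₂ ∨₂ w₂) else (λ _ → 0ℚ)) (z₁ , z₂)
                     ≡ (if b then S₁.e (a₁ ∨₁ w₁) else (λ _ → 0ℚ)) z₁ *ℚ S₂.e w₂ z₂
    by-cases true  = trans (e-⊗ _ _ z₁ z₂) (cong (λ t → S₁.e (a₁ ∨₁ w₁) z₁ *ℚ S₂.e t z₂) (bot-least G₂ w₂))
    by-cases false = sym (ℚ.*-zeroˡ (S₂.e w₂ z₂))

  Lmat-⊗ʳ : ∀ a₂ z₁ z₂ w₁ w₂ → S.Lmat (0̂₁ , a₂) (z₁ , z₂) (w₁ , w₂) ≡ S₁.e w₁ z₁ *ℚ S₂.Lmat a₂ z₂ w₂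
  Lmat-⊗ʳ a₂ z₁ z₂ w₁ w₂ =
    trans (cong (λ b → (if b then S.e (0̂₁ ∨₁ w₁ , a₂ ∨₂ w₂) else (λ _ → 0ℚ)) (z₁ , z₂)) disjoint)
          (by-cases ((a₂ ∧₂ w₂) ≡ᵇ₂ 0̂₂))
    where
    disjoint : _≡ᵇ_ (L₁ ⊗ L₂) (0̂₁ ∧₁ w₁ , a₂ ∧₂ w₂) (0̂₁ , 0̂₂) ≡ (a₂ ∧₂ w₂) ≡ᵇ₂ 0̂₂
    disjoint = trans (≡ᵇ-⊗ _ _ _ _) (cong (_∧ _) (Lat₁.≡⇒≡ᵇ (Geo₁.0̂-∧ w₁)))
    by-cases : ∀ b → (if b then S.e (0̂₁ ∨₁ w₁ , a₂ ∨₂ w₂) else (λ _ → 0ℚ)) (z₁ , z₂)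
                     ≡ S₁.e w₁ z₁ *ℚ (if b then S₂.e (a₂ ∨₂ w₂) else (λ _ → 0ℚ)) z₂
    by-cases true  = trans (e-⊗ _ _ z₁ z₂) (cong (λ t → S₁.e t z₁ *ℚ S₂.e (a₂ ∨₂ w₂) z₂) (bot-least G₁ w₁))
    by-cases false = sym (ℚ.*-zeroʳ (S₁.e w₁ z₁))

  H-⊗ : ∀ z₁ z₂ w₁ w₂ → S.H (z₁ , z₂) (w₁ , w₂) ≡ S₁.e z₁ w₁ *ℚ S₂.H z₂ w₂ +ℚ S₁.H z₁ w₁ *ℚ S₂.e z₂ w₂
  H-⊗ z₁ z₂ w₁ w₂ =
    trans (∑-atoms-⊗ (λ a → ½ *ℚ (S.Lmat a (z₁ , z₂) (w₁ , w₂) +ℚ S.Lmat a (w₁ , w₂) (z₁ , z₂))))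
          (cong₂ _+ℚ_ (trans (∑-cong (atoms L₂) term₂) (∑-*ˡ (atoms L₂) (S₁.e z₁ w₁) h₂))
                      (trans (∑-cong (atoms L₁) term₁) (∑-*ʳ (atoms L₁) (S₂.e z₂ w₂) h₁)))
    where
    h₁ : Carrier L₁ → ℚ
    h₁ a₁ = ½ *ℚ (S₁.Lmat a₁ z₁ w₁ +ℚ S₁.Lmat a₁ w₁ z₁)
    h₂ : Carrier L₂ → ℚ
    h₂ a₂ = ½ *ℚ (S₂.Lmat a₂ z₂ w₂ +ℚ S₂.Lmat a₂ w₂ z₂)
    term₂ : ∀ a₂ → ½ *ℚ (S.Lmat (0̂₁ , a₂) (z₁ , z₂) (w₁ , w₂) +ℚ S.Lmat (0̂₁ , a₂) (w₁ , w₂) (z₁ , z₂))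
                   ≡ S₁.e z₁ w₁ *ℚ h₂ a₂
    term₂ a₂ rewrite Lmat-⊗ʳ a₂ z₁ z₂ w₁ w₂ | Lmat-⊗ʳ a₂ w₁ w₂ z₁ z₂ | SP₁.e-sym w₁ z₁ =
      solve 4 (λ h e l l′ → h :* (e :* l :+ e :* l′) := e :* (h :* (l :+ l′))) refl
              ½ (S₁.e z₁ w₁) (S₂.Lmat a₂ z₂ w₂) (S₂.Lmat a₂ w₂ z₂)
    term₁ : ∀ a₁ → ½ *ℚ (S.Lmat (a₁ , 0̂₂) (z₁ , z₂) (w₁ , w₂) +ℚ S.Lmat (a₁ , 0̂₂) (w₁ , w₂) (z₁ , z₂))
                   ≡ h₁ a₁ *ℚ S₂.e z₂ w₂
    term₁ a₁ rewrite Lmat-⊗ˡ a₁ z₁ z₂ w₁ w₂ | Lmat-⊗ˡ a₁ w₁ w₂ z₁ z₂ | SP₂.e-sym w₂ z₂ =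
      solve 4 (λ h e l l′ → h :* (l :* e :+ l′ :* e) := (h :* (l :+ l′)) :* e) refl
              ½ (S₂.e z₂ w₂) (S₁.Lmat a₁ z₁ w₁) (S₁.Lmat a₁ w₁ z₁)

  _⊗ᵛ_ : S₁.Vect → S₂.Vect → S.Vect
  (u ⊗ᵛ v) (z₁ , z₂) = u z₁ *ℚ v z₂

  apply-H-⊗ : ∀ u v z₁ z₂ → S.apply S.H (u ⊗ᵛ v) (z₁ , z₂)
                            ≡ S₁.apply S₁.H u z₁ *ℚ v z₂ +ℚ u z₁ *ℚ S₂.apply S₂.H v z₂
  apply-H-⊗ u v z₁ z₂ = begin
    ∑ E (λ w → S.H (z₁ , z₂) w *ℚ (u ⊗ᵛ v) w)
      ≡⟨ ∑-cong E (λ (w₁ , w₂) → trans (cong (_*ℚ (u w₁ *ℚ v w₂)) (H-⊗ z₁ z₂ w₁ w₂))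
                                       (regroup (S₁.e z₁ w₁) (S₂.H z₂ w₂) (S₁.H z₁ w₁) (S₂.e z₂ w₂) (u w₁) (v w₂))) ⟩
    ∑ E (λ w → H₁u (proj₁ w) *ℚ e₂v (proj₂ w) +ℚ e₁u (proj₁ w) *ℚ H₂v (proj₂ w))
      ≡⟨ ∑-+ E (λ w → H₁u (proj₁ w) *ℚ e₂v (proj₂ w)) (λ w → e₁u (proj₁ w) *ℚ H₂v (proj₂ w)) ⟩
    ∑ E (λ w → H₁u (proj₁ w) *ℚ e₂v (proj₂ w)) +ℚ ∑ E (λ w → e₁u (proj₁ w) *ℚ H₂v (proj₂ w))
      ≡⟨ cong₂ _+ℚ_ (∑-cartesianProduct-* (elems L₁) (elems L₂) H₁u e₂v)
                    (∑-cartesianProduct-* (elems L₁) (elems L₂) e₁u H₂v) ⟩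
    S₁.apply S₁.H u z₁ *ℚ S₂.⟨ S₂.e z₂ , v ⟩ +ℚ S₁.⟨ S₁.e z₁ , u ⟩ *ℚ S₂.apply S₂.H v z₂
      ≡⟨ cong₂ (λ s t → S₁.apply S₁.H u z₁ *ℚ s +ℚ t *ℚ S₂.apply S₂.H v z₂) (SP₂.⟨e,-⟩ z₂ v) (SP₁.⟨e,-⟩ z₁ u) ⟩
    S₁.apply S₁.H u z₁ *ℚ v z₂ +ℚ u z₁ *ℚ S₂.apply S₂.H v z₂ ∎
    where
    open ≡-Reasoning
    E = elems (L₁ ⊗ L₂)
    H₁u e₁u : Carrier L₁ → ℚ
    H₁u w₁ = S₁.H z₁ w₁ *ℚ u w₁
    e₁u w₁ = S₁.e z₁ w₁ *ℚ u w₁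
    H₂v e₂v : Carrier L₂ → ℚ
    H₂v w₂ = S₂.H z₂ w₂ *ℚ v w₂
    e₂v w₂ = S₂.e z₂ w₂ *ℚ v w₂
    regroup : ∀ e₁ h₂ h₁ e₂ a b →
              (e₁ *ℚ h₂ +ℚ h₁ *ℚ e₂) *ℚ (a *ℚ b) ≡ (h₁ *ℚ a) *ℚ (e₂ *ℚ b) +ℚ (e₁ *ℚ a) *ℚ (h₂ *ℚ b)
    regroup = solve 6 (λ e₁ h₂ h₁ e₂ a b →
                (e₁ :* h₂ :+ h₁ :* e₂) :* (a :* b) := (h₁ :* a) :* (e₂ :* b) :+ (e₁ :* a) :* (h₂ :* b)) refl

  Hpow-e-⊗ : ∀ y₁ y₂ n z₁ z₂ →
             S.Hpow n (S.e (y₁ , y₂)) (z₁ , z₂)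
             ≡ ∑-antidiag n (λ i j → pascal i j *ℚ (S₁.Hpow i (S₁.e y₁) z₁ *ℚ S₂.Hpow j (S₂.e y₂) z₂))
  Hpow-e-⊗ y₁ y₂ n z₁ z₂ =
    trans (SP.Hpow-cong (λ (w₁ , w₂) → e-⊗ y₁ y₂ w₁ w₂) n (z₁ , z₂))
          (SP.Hpow-binomial (λ i j → S₁.Hpow i (S₁.e y₁) ⊗ᵛ S₂.Hpow j (S₂.e y₂))
                            (λ i j (z₁ , z₂) → apply-H-⊗ _ _ z₁ z₂) n (z₁ , z₂))

  Hpow-e-⊗-off-degree : ∀ x₁ y₁ x₂ y₂ i j →
                        i + j ≡ (rk G₁ y₁ ∸ rk G₁ x₁) + (rk G₂ y₂ ∸ rk G₂ x₂) → i ≢ rk G₁ y₁ ∸ rk G₁ x₁ →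
                        S₁.Hpow i (S₁.e y₁) x₁ *ℚ S₂.Hpow j (S₂.e y₂) x₂ ≡ 0ℚ
  Hpow-e-⊗-off-degree x₁ y₁ x₂ y₂ i j on-degree i≢d₁ with i+j≡m+n⇒i≢m⇒i<m⊎j<n on-degree i≢d₁
  ... | inj₁ i<d₁ =
    trans (cong (_*ℚ S₂.Hpow j (S₂.e y₂) x₂) (Ham₁.Hpow-e-vanishes y₁ i x₁ (i<n∸m⇒m+i<n i<d₁)))
          (ℚ.*-zeroˡ (S₂.Hpow j (S₂.e y₂) x₂))
  ... | inj₂ j<d₂ =
    trans (cong (S₁.Hpow i (S₁.e y₁) x₁ *ℚ_) (Ham₂.Hpow-e-vanishes y₂ j x₂ (i<n∸m⇒m+i<n j<d₂)))
          (ℚ.*-zeroʳ (S₁.Hpow i (S₁.e y₁) x₁))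

corollary6p2 : (L₁ L₂ : FinLattice) (G₁ : IsGeometric L₁) (G₂ : IsGeometric L₂)
  (x₁ y₁ : Carrier L₁) (x₂ y₂ : Carrier L₂) →
  _≤L_ (L₁ ⊗ L₂) (x₁ , x₂) (y₁ , y₂) →
  let d₁ = rk G₁ y₁ ∸ rk G₁ x₁
      d₂ = rk G₂ y₂ ∸ rk G₂ x₂
      d = d₁ + d₂
  in Space.⟨_,_⟩ (L₁ ⊗ L₂) (Space.e (L₁ ⊗ L₂) (x₁ , x₂)) (Space.Hpow (L₁ ⊗ L₂) d (Space.e (L₁ ⊗ L₂) (y₁ , y₂)))
     ≡ (ℕ→ℚ (d C d₁) *ℚ Space.⟨_,_⟩ L₁ (Space.e L₁ x₁) (Space.Hpow L₁ d₁ (Space.e L₁ y₁)))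
         *ℚ Space.⟨_,_⟩ L₂ (Space.e L₂ x₂) (Space.Hpow L₂ d₂ (Space.e L₂ y₂))
corollary6p2 L₁ L₂ G₁ G₂ x₁ y₁ x₂ y₂ _ = begin
  S.⟨ S.e (x₁ , x₂) , S.Hpow (d₁ + d₂) (S.e (y₁ , y₂)) ⟩ ≡⟨ SP.⟨e,-⟩ (x₁ , x₂) (S.Hpow (d₁ + d₂) (S.e (y₁ , y₂))) ⟩
  S.Hpow (d₁ + d₂) (S.e (y₁ , y₂)) (x₁ , x₂)             ≡⟨ Hpow-e-⊗ y₁ y₂ (d₁ + d₂) x₁ x₂ ⟩
  ∑-antidiag (d₁ + d₂) (λ i j → pascal i j *ℚ (A i *ℚ B j))
    ≡⟨ ∑-antidiag-single d₁ d₂ (λ i j → pascal i j *ℚ (A i *ℚ B j)) (λ i j on-degree i≢d₁ →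
         trans (cong (pascal i j *ℚ_) (Hpow-e-⊗-off-degree x₁ y₁ x₂ y₂ i j on-degree i≢d₁)) (ℚ.*-zeroʳ (pascal i j))) ⟩
  pascal d₁ d₂ *ℚ (A d₁ *ℚ B d₂)
    ≡⟨ cong₂ _*ℚ_ (pascal≡C d₁ d₂) (sym (cong₂ _*ℚ_ (SP₁.⟨e,-⟩ x₁ (S₁.Hpow d₁ (S₁.e y₁)))
                                                   (SP₂.⟨e,-⟩ x₂ (S₂.Hpow d₂ (S₂.e y₂))))) ⟩
  ℕ→ℚ ((d₁ + d₂) C d₁) *ℚ (entry₁ *ℚ entry₂)  ≡⟨ sym (ℚ.*-assoc (ℕ→ℚ ((d₁ + d₂) C d₁)) _ _) ⟩
  (ℕ→ℚ ((d₁ + d₂) C d₁) *ℚ entry₁) *ℚ entry₂  ∎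
  where
  open ≡-Reasoning
  open ProductProperties L₁ L₂ G₁ G₂
  d₁ = rk G₁ y₁ ∸ rk G₁ x₁
  d₂ = rk G₂ y₂ ∸ rk G₂ x₂
  A = λ i → S₁.Hpow i (S₁.e y₁) x₁
  B = λ j → S₂.Hpow j (S₂.e y₂) x₂
  entry₁ = S₁.⟨ S₁.e x₁ , S₁.Hpow d₁ (S₁.e y₁) ⟩
  entry₂ = S₂.⟨ S₂.e x₂ , S₂.Hpow d₂ (S₂.e y₂) ⟩
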